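{- Let $X\neq\emptyset$ and $M:X\to\mathcal{P}(X)$ satisfy, for all $x,y\in X$: $x\in M(x)\Leftrightarrow M(x)=X$, and $x\in M(y)\Leftrightarrow y\in M(x)$. Let $\mathbb{B}_X:=\{\alpha\subseteq X:\alpha=\bigcap\{M(x):x\in X,\ \alpha\subseteq M(x)\}\}$ (with $\bigcap\emptyset:=X$), a complete Boolean algebra under inclusion in which the complement of $\alpha$ is $-\alpha=\bigcap\{M(x):x\in\alpha\}$, and which contains every $M(y)$. For $y\in X$ let $m(y):=\bigcap\{M(x):y\in M(x)\}$. Then $m(y)=-M(y)$. -}

module Defs where

open import Level using (Level; _⊔_)
open import Relation.Unary using (Pred; _∈_; _⊆_; _≐_; U)
open import Function.Bundles using (_⇔_)

private variable a ℓ ℓ′ : Level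

⋂[_]_ : {X : Set a} → Pred X ℓ′ → (X → Pred X ℓ) → Pred X (a ⊔ ℓ′ ⊔ ℓ)
(⋂[ P ] M) z = ∀ x → P x → z ∈ M x

IsReflexiveCond : {X : Set a} → (X → Pred X ℓ) → Set (a ⊔ ℓ)
IsReflexiveCond {X = X} M = ∀ (x : X) → (x ∈ M x) ⇔ (M x ≐ U)

IsSymmetricCond : {X : Set a} → (X → Pred X ℓ) → Set (a ⊔ ℓ)
IsSymmetricCond {X = X} M = ∀ (x y : X) → (x ∈ M y) ⇔ (y ∈ M x)

closure : {X : Set a} → (X → Pred X ℓ) → Pred X ℓ → Pred X (a ⊔ ℓ)
closure M α = ⋂[ (λ x → α ⊆ M x) ] M

InBX : {X : Set a} → (X → Pred X ℓ) → Pred X ℓ → Set (a ⊔ ℓ)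
InBX M α = α ≐ closure M α

neg : {X : Set a} → (X → Pred X ℓ) → Pred X ℓ → Pred X (a ⊔ ℓ)
neg M α = ⋂[ α ] M

m : {X : Set a} → (X → Pred X ℓ) → X → Pred X (a ⊔ ℓ)
m M y = ⋂[ (λ x → y ∈ M x) ] M

module Submission where

open import Defs
open import Level using (Level)
open import Relation.Unary using (Pred; _≐_)
open import Function.Bundles using (module Equivalence)
open import Data.Product using (_,_)

-- Only symmetry matters: it makes the index sets {x : y ∈ M x} and M y coincide,
-- so m(y) and -M(y) are intersections of the same family.
m≐neg-M-of-symmetric : {a ℓ : Level} {X : Set a} (M : X → Pred X ℓ) →
                       IsSymmetricCond M → (y : X) → m M y ≐ neg M (M y)
m≐neg-M-of-symmetric M sym y =
  (λ z∈m x x∈My → z∈m x (Equivalence.to (sym x y) x∈My)) ,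
  (λ z∈neg x y∈Mx → z∈neg x (Equivalence.from (sym x y) y∈Mx))

proposition4p3 : {a ℓ : Level} {X : Set a} (M : X → Pred X ℓ) →
                 (x₀ : X) → IsReflexiveCond M → IsSymmetricCond M →
                 (y : X) → m M y ≐ neg M (M y)
proposition4p3 M _ _ sym = m≐neg-M-of-symmetric M sym
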